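{- Let $\delta\colon Conn_T\to PSC$ be the functor that is the identity on objects and sends a connection $(s,i)\colon T\leftrightarrows S$ to $(s^{i(v)},i)$, where $v$ is the $\leq_S$-largest leaf of $S$. Then $\delta$ is frank; that is, for all finite ordered trees $S,T$, $$\delta(\mathrm{Hom}_{Conn_T}(S,T))=\mathrm{Hom}_{PSC}(S,T).$$
   Context: All trees are finite. A tree is a partial order $(T,\sqsubseteq_T)$ with a least element (the root) such that the predecessors of every element are linearly ordered; $v\wedge_T w$ is the largest common predecessor; a leaf is a $\sqsubseteq$-maximal element. A tree is ordered if each set of immediate successors carries a linear order; this induces a linear order $\leq_T$ on $T$: $v\leq_T w$ iff $v\sqsubseteq_T w$, or $w\not\sqsubseteq_T v$ and the immediate successor of $v\wedge w$ below $v$ precedes the one below $w$. An embedding $i\colon S\to T$ sends root to root, satisfies $x<_S y\Rightarrow i(x)<_T i(y)$, and $i(x\wedge y)=i(x)\wedge i(y)$. A map $s\colon T\to S$ is a rigid surjection if there is an embedding $i\colon S\to T$ with $s(i(x))=x$ and $i(s(y))\sqsubseteq_T y$ for all $x,y$. A connection $(s,i)\colon T\leftrightarrows S$ is a pair with $s\colon T\to S$ a rigid surjection, $i\colon S\to T$ an embedding, and for all $x\in S$: $s(i(x))=x$ and $s(y)\leq_S x$ for all $y<_T i(x)$. It is strong if $i$ maps the $\leq_S$-largest leaf of $S$ to the $\leq_T$-largest leaf of $T$. $Conn_T$: objects finite ordered trees, $\mathrm{Hom}_{Conn_T}(S,T)$ = connections $(s,i)\colon T\leftrightarrows S$, composition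 $(t,j)\circ(s,i)=(s\circ t,j\circ i)$. For $v\in T$, $T^v=\{y\in T\colon y\leq_T v\}$ with inherited structure and $s^v=s\restriction T^v$. $PSC$: objects finite ordered trees, $\mathrm{Hom}_{PSC}(S,T)=\{(s,i)\colon T^v\leftrightarrows S\mid v\in T,\ (s,i)\text{ a strong connection}\}$, with composition $(s,i)\circ(t,j)=(t\circ s^{i(v)},\ i\restriction T^v\circ j)$ for $(t,j)\colon T^v\leftrightarrows S$. A functor $\delta\colon\mathcal C\to\mathcal D$ is frank at $A$ if for every object $D$ of $\mathcal D$ there is an object $B$ of $\mathcal C$ with $\delta(B)=D$ and $\delta(\mathrm{Hom}_{\mathcal C}(A,B))=\mathrm{Hom}_{\mathcal D}(\delta(A),D)$. -}

module Defs where

open import Data.List using (List; length; lookup)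
open import Data.Fin using (Fin; toℕ; _≟_)
open import Data.Nat using (_<ᵇ_)
open import Data.Bool using (Bool; true; false; T)
open import Data.Product using (Σ; _×_; _,_; proj₁; proj₂)
open import Relation.Nullary using (¬_; yes; no)
open import Relation.Binary.PropositionalEquality using (_≡_; _≢_; refl)

-- Finite ordered trees (rose trees; the list order of children is the
-- linear order on each set of immediate successors) and their elements.

data Tree : Set where
  node : List Tree → Tree

data Pos : Tree → Set where
  root  : ∀ {ts} → Pos (node ts)
  child : ∀ {ts} (k : Fin (length ts)) → Pos (lookup ts k) → Pos (node ts)

_⊑ᵇ_ : ∀ {t} → Pos t → Pos t → Bool
root      ⊑ᵇ _         = true
child k p ⊑ᵇ root      = false
child k p ⊑ᵇ child l q with k ≟ l
... | yes refl = p ⊑ᵇ q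
... | no  _    = false

-- Induced linear order ≤ : v ≤ w iff v ⊑ w, or w ⋢ v and the immediate
-- successor of v ∧ w below v precedes the one below w (unfolded recursively).
_≤ᵇ_ : ∀ {t} → Pos t → Pos t → Bool
root      ≤ᵇ _         = true
child k p ≤ᵇ root      = false
child k p ≤ᵇ child l q with k ≟ l
... | yes refl = p ≤ᵇ q
... | no  _    = toℕ k <ᵇ toℕ l

-- A (finite ordered) tree presented by its carrier, tree order and
-- linear order.  Used both for trees T and for the subtrees T^v.

record OTree : Set₁ where
  field
    Carrier : Set
    _⊑_     : Carrier → Carrier → Set
    _≤_     : Carrier → Carrier → Set

open OTree public

module _ (A : OTree) where
  private
    C = Carrier A
    _⊑A_ = _⊑_ A
    _≤A_ = _≤_ A

  Lt : C → C → Set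
  Lt x y = (x ≤A y) × (x ≢ y)

  IsRoot : C → Set
  IsRoot r = ∀ y → r ⊑A y

  IsMeet : C → C → C → Set
  IsMeet x y m = (m ⊑A x) × (m ⊑A y) × (∀ z → z ⊑A x → z ⊑A y → z ⊑A m)

  IsLeaf : C → Set
  IsLeaf x = ∀ y → x ⊑A y → y ≡ x

  IsLargestLeaf : C → Set
  IsLargestLeaf x = IsLeaf x × (∀ y → IsLeaf y → y ≤A x)

Embedding : (S T : OTree) → (Carrier S → Carrier T) → Set
Embedding S T i =
    (∀ r → IsRoot S r → IsRoot T (i r))
  × (∀ x y → Lt S x y → Lt T (i x) (i y))
  × (∀ x y m → IsMeet S x y m → IsMeet T (i x) (i y) (i m))

RigidSurjection : (T S : OTree) → (Carrier T → Carrier S) → Set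
RigidSurjection T S s =
  Σ (Carrier S → Carrier T) λ i →
      Embedding S T i
    × (∀ x → s (i x) ≡ x)
    × (∀ y → _⊑_ T (i (s y)) y)

Connection : (T S : OTree) → (Carrier T → Carrier S) → (Carrier S → Carrier T) → Set
Connection T S s i =
    RigidSurjection T S s
  × Embedding S T i
  × (∀ x → s (i x) ≡ x)
  × (∀ x y → Lt T y (i x) → _≤_ S (s y) x)

StrongConnection : (T S : OTree) → (Carrier T → Carrier S) → (Carrier S → Carrier T) → Set
StrongConnection T S s i =
    Connection T S s i
  × (∀ v → IsLargestLeaf S v → IsLargestLeaf T (i v))

⟦_⟧ : Tree → OTree
⟦ t ⟧ = record
  { Carrier = Pos t
  ; _⊑_     = λ x y → T (x ⊑ᵇ y)
  ; _≤_     = λ x y → T (x ≤ᵇ y)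
  }

_^_ : (t : Tree) → Pos t → OTree
t ^ v = record
  { Carrier = Σ (Pos t) (λ y → T (y ≤ᵇ v))
  ; _⊑_     = λ x y → T (proj₁ x ⊑ᵇ proj₁ y)
  ; _≤_     = λ x y → T (proj₁ x ≤ᵇ proj₁ y)
  }

record ConnHom (S T : Tree) : Set where
  constructor conn
  field
    s    : Pos T → Pos S
    i    : Pos S → Pos T
    isConn : Connection ⟦ T ⟧ ⟦ S ⟧ s i

record PSCHom (S T : Tree) : Set where
  constructor psc
  field
    v    : Pos T
    s    : Carrier (T ^ v) → Pos S
    i    : Pos S → Carrier (T ^ v)
    isStrong : StrongConnection (T ^ v) ⟦ S ⟧ s i

δ-maps : ∀ {S T} → ConnHom S T → PSCHom S T → Set
δ-maps {S} {T} c p =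
  ∀ v → IsLargestLeaf ⟦ S ⟧ v →
      (PSCHom.v p ≡ ConnHom.i c v)
    × (∀ y → PSCHom.s p y ≡ ConnHom.s c (proj₁ y))
    × (∀ x → proj₁ (PSCHom.i p x) ≡ ConnHom.i c x)

{-# OPTIONS --safe #-}
module Submission where

-- Embeddings are ≤-monotone, so a connection (s , i) : T ⇄ S maps all of S into T^{i(v)},
-- v the ≤-maximum (hence the largest leaf) of S, and i(v) is the top of T^{i(v)}; restricting
-- s gives a strong connection. Conversely, strongness forces a strong connection T^u ⇄ S to
-- send v to u itself, and s extends to T by its value at the root: the connection condition
-- only concerns points below some i(x), which already lie in T^u.

open import Defs
open import Data.Bool using (T)
open import Data.Bool.Properties using (T-irrelevant)
open import Data.Empty using (⊥-elim)
open import Data.Fin using (Fin; zero; suc; toℕ; fromℕ; _≟_)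
open import Data.Fin.Properties using (≤fromℕ; ≤∧≢⇒<)
open import Data.List using (List; []; _∷_; length; lookup)
open import Data.Nat.Properties using (<ᵇ⇒<; <⇒<ᵇ; <-trans; <-asym)
open import Data.Product using (Σ; _×_; _,_; proj₁; proj₂)
open import Data.Unit using (tt)
open import Function using (_∘_)
open import Relation.Nullary using (yes; no; contradiction)
open import Relation.Nullary.Decidable using (T?)
open import Relation.Binary.PropositionalEquality using (_≡_; refl; sym; trans; cong; subst)

≤ᵇ-refl : ∀ {t} (x : Pos t) → T (x ≤ᵇ x)
≤ᵇ-refl root = tt
≤ᵇ-refl (child k p) with k ≟ k
... | yes refl = ≤ᵇ-refl p
... | no k≢k   = contradiction refl k≢k

≤ᵇ-antisym : ∀ {t} (x y : Pos t) → T (x ≤ᵇ y) → T (y ≤ᵇ x) → x ≡ y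
≤ᵇ-antisym root        root        _   _   = refl
≤ᵇ-antisym root        (child _ _) _   ()
≤ᵇ-antisym (child _ _) root        ()  _
≤ᵇ-antisym (child k p) (child l q) x≤y y≤x with k ≟ l | l ≟ k
... | yes refl | yes refl = cong (child k) (≤ᵇ-antisym p q x≤y y≤x)
... | yes refl | no k≢k   = contradiction refl k≢k
... | no k≢l   | yes refl = contradiction refl k≢l
... | no _     | no _     = ⊥-elim (<-asym (<ᵇ⇒< (toℕ k) (toℕ l) x≤y) (<ᵇ⇒< (toℕ l) (toℕ k) y≤x))

≤ᵇ-trans : ∀ {t} (x y z : Pos t) → T (x ≤ᵇ y) → T (y ≤ᵇ z) → T (x ≤ᵇ z)
≤ᵇ-trans root        _           _           _   _   = tt
≤ᵇ-trans (child _ _) root        _           ()  _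
≤ᵇ-trans (child _ _) (child _ _) root        _   ()
≤ᵇ-trans (child k p) (child l q) (child m r) x≤y y≤z
  with k ≟ l | l ≟ m | k ≟ m
... | yes refl | yes refl | yes refl = ≤ᵇ-trans p q r x≤y y≤z
... | yes refl | yes refl | no k≢k   = contradiction refl k≢k
... | yes refl | no k≢k   | yes refl = contradiction refl k≢k
... | yes refl | no _     | no _     = y≤z
... | no k≢k   | yes refl | yes refl = contradiction refl k≢k
... | no _     | yes refl | no _     = x≤y
... | no _     | no _     | yes refl = ⊥-elim (<-asym (<ᵇ⇒< (toℕ k) (toℕ l) x≤y) (<ᵇ⇒< (toℕ l) (toℕ k) y≤z))
... | no _     | no _     | no _     = <⇒<ᵇ (<-trans (<ᵇ⇒< (toℕ k) (toℕ l) x≤y) (<ᵇ⇒< (toℕ l) (toℕ m) y≤z))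

⊑ᵇ⇒≤ᵇ : ∀ {t} (x y : Pos t) → T (x ⊑ᵇ y) → T (x ≤ᵇ y)
⊑ᵇ⇒≤ᵇ root        _           _   = tt
⊑ᵇ⇒≤ᵇ (child _ _) root        ()
⊑ᵇ⇒≤ᵇ (child k p) (child l q) x⊑y with k ≟ l
... | yes refl = ⊑ᵇ⇒≤ᵇ p q x⊑y
... | no _     = ⊥-elim x⊑y

rootOf : (t : Tree) → Pos t
rootOf (node _) = root

rootOf-⊑ᵇ : (t : Tree) (y : Pos t) → T (rootOf t ⊑ᵇ y)
rootOf-⊑ᵇ (node _) _ = tt

rootOf-≤ᵇ : (t : Tree) (y : Pos t) → T (rootOf t ≤ᵇ y)
rootOf-≤ᵇ t y = ⊑ᵇ⇒≤ᵇ (rootOf t) y (rootOf-⊑ᵇ t y)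

⊑ᵇ-rootOf⇒≡ : (t : Tree) (x : Pos t) → T (x ⊑ᵇ rootOf t) → x ≡ rootOf t
⊑ᵇ-rootOf⇒≡ (node _) root        _  = refl
⊑ᵇ-rootOf⇒≡ (node _) (child _ _) ()

IsMaximum : (t : Tree) → Pos t → Set
IsMaximum t m = ∀ x → T (x ≤ᵇ m)

Maximum : Tree → Set
Maximum t = Σ (Pos t) (IsMaximum t)

maximum-lastChild : ∀ {t ts} → Maximum (lookup (t ∷ ts) (fromℕ (length ts))) → Maximum (node (t ∷ ts))
maximum-lastChild {t} {ts} (m , max) = child last m , below
  where
    last : Fin (length (t ∷ ts))
    last = fromℕ (length ts)
    below : IsMaximum (node (t ∷ ts)) (child last m)
    below root = tt
    below (child l q) with l ≟ last
    ... | yes refl  = max q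
    ... | no l≢last = <⇒<ᵇ (≤∧≢⇒< (≤fromℕ l) l≢last)

mutual
  maximum : (t : Tree) → Maximum t
  maximum (node [])       = root , λ { root → tt }
  maximum (node (t ∷ ts)) = maximum-lastChild (maximumAt (t ∷ ts) (fromℕ (length ts)))

  maximumAt : (ts : List Tree) (k : Fin (length ts)) → Maximum (lookup ts k)
  maximumAt (t ∷ ts) zero    = maximum t
  maximumAt (t ∷ ts) (suc k) = maximumAt ts k

maximum⇒isLeaf : ∀ {t m} → IsMaximum t m → IsLeaf ⟦ t ⟧ m
maximum⇒isLeaf {m = m} max y m⊑y = ≤ᵇ-antisym y m (max y) (⊑ᵇ⇒≤ᵇ m y m⊑y)

largestLeaf≡maximum : ∀ {t m w} → IsMaximum t m → IsLargestLeaf ⟦ t ⟧ w → w ≡ m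
largestLeaf≡maximum {m = m} {w} max (_ , largest) =
  ≤ᵇ-antisym w m (max w) (largest m (maximum⇒isLeaf max))

^-≡ : ∀ {t v} {x y : Carrier (t ^ v)} → proj₁ x ≡ proj₁ y → x ≡ y
^-≡ {x = x , p} {y = .x , q} refl = cong (x ,_) (T-irrelevant p q)

^-root : (t : Tree) (v : Pos t) → Carrier (t ^ v)
^-root t v = rootOf t , rootOf-≤ᵇ t v

top-isLargestLeaf : (t : Tree) (v : Pos t) (v≤v : T (v ≤ᵇ v)) → IsLargestLeaf (t ^ v) (v , v≤v)
top-isLargestLeaf t v v≤v =
    (λ y v⊑y → ^-≡ (≤ᵇ-antisym (proj₁ y) v (proj₂ y) (⊑ᵇ⇒≤ᵇ v (proj₁ y) v⊑y)))
  , (λ y _ → proj₂ y)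

embedding-monotone : ∀ {S t i} → Embedding ⟦ S ⟧ ⟦ t ⟧ i → ∀ x y → T (x ≤ᵇ y) → T (i x ≤ᵇ i y)
embedding-monotone {i = i} (_ , <-pres , _) x y x≤y with T? (y ≤ᵇ x)
... | yes y≤x = subst (λ z → T (i x ≤ᵇ i z)) (≤ᵇ-antisym x y x≤y y≤x) (≤ᵇ-refl (i x))
... | no  y≰x = proj₁ (<-pres x y (x≤y , λ { refl → y≰x (≤ᵇ-refl y) }))

embedding-into-^ : ∀ {A t} (v : Pos t) {i : Carrier A → Pos t} (i≤v : ∀ x → T (i x ≤ᵇ v)) →
  Embedding A ⟦ t ⟧ i → Embedding A (t ^ v) (λ x → i x , i≤v x)
embedding-into-^ v i≤v (root-pres , <-pres , meet-pres) =
    (λ r isRoot y → root-pres r isRoot (proj₁ y))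
  , (λ x y x<y → let (ix≤iy , ix≢iy) = <-pres x y x<y in ix≤iy , ix≢iy ∘ cong proj₁)
  , (λ x y m isMeet → let (m⊑x , m⊑y , greatest) = meet-pres x y m isMeet in
       m⊑x , m⊑y , greatest ∘ proj₁)

embedding-from-^ : ∀ {A t} (v : Pos t) {i : Carrier A → Carrier (t ^ v)} →
  Embedding A (t ^ v) i → Embedding A ⟦ t ⟧ (proj₁ ∘ i)
embedding-from-^ {A} {t} v {i} (root-pres , <-pres , meet-pres) =
    (λ r isRoot y → subst (λ z → T (z ⊑ᵇ y)) (sym (i-root r isRoot)) (rootOf-⊑ᵇ t y))
  , (λ x y x<y → let (ix≤iy , ix≢iy) = <-pres x y x<y in ix≤iy , ix≢iy ∘ ^-≡)
  , (λ x y m isMeet → let (m⊑x , m⊑y , greatest) = meet-pres x y m isMeet in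
       m⊑x , m⊑y , λ z z⊑x → greatest (z , ⊑-below-^ x z z⊑x) z⊑x)
  where
    i-root : ∀ r → IsRoot A r → proj₁ (i r) ≡ rootOf t
    i-root r isRoot = ⊑ᵇ-rootOf⇒≡ t (proj₁ (i r)) (root-pres r isRoot (^-root t v))
    ⊑-below-^ : ∀ x z → T (z ⊑ᵇ proj₁ (i x)) → T (z ≤ᵇ v)
    ⊑-below-^ x z z⊑ix = ≤ᵇ-trans z (proj₁ (i x)) v (⊑ᵇ⇒≤ᵇ z (proj₁ (i x)) z⊑ix) (proj₂ (i x))

restrict-connection : ∀ {S t s i} (u : Pos t) (i≤u : ∀ x → T (i x ≤ᵇ u)) →
  Connection ⟦ t ⟧ ⟦ S ⟧ s i → Connection (t ^ u) ⟦ S ⟧ (s ∘ proj₁) (λ x → i x , i≤u x)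
restrict-connection {i = i} u i≤u ((j , j-emb , s∘j , j∘s⊑) , i-emb , s∘i , s-below) =
    ((λ x → j x , j≤u x) , embedding-into-^ u j≤u j-emb , s∘j , j∘s⊑ ∘ proj₁)
  , embedding-into-^ u i≤u i-emb
  , s∘i
  , λ x y (y≤ix , y≢ix) → s-below x (proj₁ y) (y≤ix , y≢ix ∘ ^-≡)
  where
    j⊑i : ∀ x → T (j x ⊑ᵇ i x)
    j⊑i x = subst (λ z → T (j z ⊑ᵇ i x)) (s∘i x) (j∘s⊑ (i x))
    j≤u : ∀ x → T (j x ≤ᵇ u)
    j≤u x = ≤ᵇ-trans (j x) (i x) u (⊑ᵇ⇒≤ᵇ (j x) (i x) (j⊑i x)) (i≤u x)

extend : ∀ {A : Set} {t} (v : Pos t) → (Carrier (t ^ v) → A) → Pos t → A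
extend {t = t} v f y with T? (y ≤ᵇ v)
... | yes y≤v = f (y , y≤v)
... | no  _   = f (^-root t v)

extend-agrees : ∀ {A : Set} {t} (v : Pos t) (f : Carrier (t ^ v) → A) (y : Carrier (t ^ v)) →
  extend v f (proj₁ y) ≡ f y
extend-agrees v f (y , y≤v) with T? (y ≤ᵇ v)
... | yes y≤v′ = cong (λ p → f (y , p)) (T-irrelevant y≤v′ y≤v)
... | no  y≰v  = contradiction y≤v y≰v

-- j sends s(root) back to the root of t, which lies below every point outside T^v.
extend-rigid : ∀ {S t} (v : Pos t) (s : Carrier (t ^ v) → Pos S) (j : Pos S → Carrier (t ^ v)) →
  (∀ y → T (proj₁ (j (s y)) ⊑ᵇ proj₁ y)) → ∀ y → T (proj₁ (j (extend v s y)) ⊑ᵇ y)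
extend-rigid {t = t} v s j j∘s⊑ y with T? (y ≤ᵇ v)
... | yes y≤v = j∘s⊑ (y , y≤v)
... | no  _   = subst (λ z → T (z ⊑ᵇ y)) (sym j∘s-root) (rootOf-⊑ᵇ t y)
  where
    j∘s-root : proj₁ (j (s (^-root t v))) ≡ rootOf t
    j∘s-root = ⊑ᵇ-rootOf⇒≡ t _ (j∘s⊑ (^-root t v))

extend-connection : ∀ {S t} (v : Pos t) {s : Carrier (t ^ v) → Pos S} {i} →
  Connection (t ^ v) ⟦ S ⟧ s i → Connection ⟦ t ⟧ ⟦ S ⟧ (extend v s) (proj₁ ∘ i)
extend-connection {t = t} v {s} {i} ((j , j-emb , s∘j , j∘s⊑) , i-emb , s∘i , s-below) =
    ( proj₁ ∘ j , embedding-from-^ v j-emb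
    , (λ x → trans (extend-agrees v s (j x)) (s∘j x))
    , extend-rigid v s j j∘s⊑)
  , embedding-from-^ v i-emb
  , (λ x → trans (extend-agrees v s (i x)) (s∘i x))
  , extend-below
  where
    extend-below : ∀ x y → Lt ⟦ t ⟧ y (proj₁ (i x)) → T (extend v s y ≤ᵇ x)
    extend-below x y (y≤ix , y≢ix) =
      subst (λ z → T (z ≤ᵇ x)) (sym (extend-agrees v s (y , y≤v)))
            (s-below x (y , y≤v) (y≤ix , y≢ix ∘ cong proj₁))
      where
        y≤v : T (y ≤ᵇ v)
        y≤v = ≤ᵇ-trans y (proj₁ (i x)) v y≤ix (proj₂ (i x))

strong-largestLeaf↦top : ∀ {S t} (v : Pos t) {s i} → StrongConnection (t ^ v) ⟦ S ⟧ s i →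
  ∀ w → IsLargestLeaf ⟦ S ⟧ w → proj₁ (i w) ≡ v
strong-largestLeaf↦top {t = t} v {i = i} (_ , strong) w w-largest =
  ≤ᵇ-antisym (proj₁ (i w)) v (proj₂ (i w))
    (proj₂ (strong w w-largest) (v , ≤ᵇ-refl v) (proj₁ (top-isLargestLeaf t v (≤ᵇ-refl v))))

δ : ∀ {S t} → ConnHom S t → PSCHom S t
δ {S} {t} (conn s i c@(_ , i-emb , _)) =
  psc (i top) (s ∘ proj₁) (λ x → i x , i≤i-top x) (restrict-connection (i top) i≤i-top c , strong)
  where
    top : Pos S
    top = proj₁ (maximum S)
    i≤i-top : ∀ x → T (i x ≤ᵇ i top)
    i≤i-top x = embedding-monotone i-emb x top (proj₂ (maximum S) x)
    strong : ∀ w → IsLargestLeaf ⟦ S ⟧ w → IsLargestLeaf (t ^ i top) (i w , i≤i-top w)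
    strong w w-largest rewrite largestLeaf≡maximum (proj₂ (maximum S)) w-largest =
      top-isLargestLeaf t (i top) (i≤i-top top)

δ-maps-δ : ∀ {S t} (c : ConnHom S t) → δ-maps c (δ c)
δ-maps-δ {S} (conn _ i _) w w-largest =
  cong i (sym (largestLeaf≡maximum (proj₂ (maximum S)) w-largest)) , (λ _ → refl) , (λ _ → refl)

extension : ∀ {S t} → PSCHom S t → ConnHom S t
extension (psc v s i (c , _)) = conn (extend v s) (proj₁ ∘ i) (extend-connection v c)

δ-maps-extension : ∀ {S t} (p : PSCHom S t) → δ-maps (extension p) p
δ-maps-extension (psc v s _ strong) w w-largest =
    sym (strong-largestLeaf↦top v strong w w-largest)
  , (λ y → sym (extend-agrees v s y))
  , (λ _ → refl)

lemma5p5 : (S T : Tree) →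
    ((c : ConnHom S T) → Σ (PSCHom S T) (λ p → δ-maps c p))
    × ((p : PSCHom S T) → Σ (ConnHom S T) (λ c → δ-maps c p))
lemma5p5 S T = (λ c → δ c , δ-maps-δ c) , (λ p → extension p , δ-maps-extension p)
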